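{- There is no distance-regular graph with intersection array $\{234,165,12;1,30,198\}$.
   Context: A connected graph $\Gamma$ of diameter $d$ is distance-regular if there are constants $p^h_{ij}$ ($0\le h,i,j\le d$) such that for any two vertices $u,v$ at distance $h$, the number of vertices at distance $i$ from $u$ and distance $j$ from $v$ is $p^h_{ij}$. Its intersection array is $\{b_0,b_1,\dots,b_{d-1};c_1,c_2,\dots,c_d\}$ where $b_i=p^i_{1,i+1}$ and $c_{i+1}=p^{i+1}_{1,i}$. -}

module Defs where

open import Data.Nat using (ℕ; zero; suc; _≤_)
open import Data.Bool using (Bool; true; false; _∧_; _∨_; not)
open import Data.Fin using (Fin; toℕ; _≟_)
open import Data.List using (List; length; filterᵇ; allFin)
open import Data.Bool.ListAction using (any)
open import Data.Vec using (Vec; lookup)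
open import Data.Product using (Σ; ∃; _×_)
open import Relation.Nullary.Decidable using (⌊_⌋)
open import Relation.Binary.PropositionalEquality using (_≡_)

record Graph (n : ℕ) : Set where
  field
    adj    : Fin n → Fin n → Bool
    sym    : ∀ u v → adj u v ≡ adj v u
    irrefl : ∀ u → adj u u ≡ false
open Graph public

module _ {n : ℕ} (G : Graph n) where

  within : ℕ → Fin n → Fin n → Bool
  within zero    u v = ⌊ u ≟ v ⌋
  within (suc k) u v = within k u v ∨ any (λ w → adj G u w ∧ within k w v) (allFin n)

  isDist : ℕ → Fin n → Fin n → Bool
  isDist zero    u v = ⌊ u ≟ v ⌋
  isDist (suc k) u v = within (suc k) u v ∧ not (within k u v)

  Connected : Set
  Connected = ∀ u v → ∃ λ k → within k u v ≡ true

  HasDiameter : ℕ → Set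
  HasDiameter d = (∀ u v → within d u v ≡ true)
                × Σ (Fin n) λ u → Σ (Fin n) λ v → isDist d u v ≡ true

  count : Fin n → Fin n → ℕ → ℕ → ℕ
  count u v i j = length (filterᵇ (λ w → isDist i u w ∧ isDist j v w) (allFin n))

  IsDRG : ℕ → (ℕ → ℕ → ℕ → ℕ) → Set
  IsDRG d p = Connected × HasDiameter d
            × (∀ u v h i j → h ≤ d → i ≤ d → j ≤ d →
                 isDist h u v ≡ true → count u v i j ≡ p h i j)

  -- intersection array {b_0,…,b_{d-1}; c_1,…,c_d}, with b = (b_0,…,b_{d-1}),
  -- c = (c_1,…,c_d): b_i = p^i_{1,i+1}, c_{i+1} = p^{i+1}_{1,i}
  HasIntersectionArray : (d : ℕ) → Vec ℕ d → Vec ℕ d → Set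
  HasIntersectionArray d b c =
    Σ (ℕ → ℕ → ℕ → ℕ) λ p → IsDRG d p
      × (∀ (i : Fin d) → lookup b i ≡ p (toℕ i) 1 (suc (toℕ i)))
      × (∀ (i : Fin d) → lookup c i ≡ p (suc (toℕ i)) 1 (toℕ i))

-- Let Γ be such a graph, d its distance function (values 0,…,3) and p^h_{ij} its
-- intersection numbers.  The proof has three ingredients.
--  (1) Counting.  For every ψ, ∑_w ψ(d(u,w),d(v,w)) = ∑_{a,b} ψ(a,b) p^{d(u,v)}_{ab}
--      (`pair-sum`).  It yields p^h_{0j} = δ_{hj}, the zeros forced by the triangle
--      inequality, the row sums and the associativity ∑_a p^a_{li} p^h_{aj} = ∑_b p^h_{lb} p^b_{ij};
--      these determine every p^h_{ij} from the array, row by row (`intersection-numbers`).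
--  (2) A vanishing Krein parameter.  For functions f, g of the distance put
--      T(x,y,z) = ∑_w f(d(x,w)) g(d(y,w)) g(d(z,w)); then ∑_{x,y,z} T² = ∑_{w,w'} Φ_f Φ_g² (d(w,w'))
--      with Φ_φ(h) = ∑_{a,b} φ(a) φ(b) p^h_{ab}.
--      For the standard sequences of the eigenvalues 54 and 14 this vanishes, so T ≡ 0
--      (`krein-vanishing`).
--  (3) Triple intersection numbers.  A function Λ of three distances, nonnegative everywhere,
--      sums to −204000 over w whenever x, y, z are mutually at distance 3 (using T ≡ 0 and the
--      p^3_{ab}); so no such triple exists (`no-triangle`), whereas p^3_{33} = 8 > 0 produces one.
module Submission where

open import Defs hiding (sym)
open import Data.Bool using (Bool; true; false; _∧_; _∨_; not; T)
open import Data.Bool.ListAction using (any)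
open import Data.Empty using (⊥; ⊥-elim)
open import Data.Fin using (Fin; zero; suc; toℕ; _≟_; inject₁)
open import Data.Fin.Patterns using (0F; 1F; 2F; 3F)
open import Data.Fin.Properties using (suc-injective; toℕ≤pred[n]; all?)
open import Data.Integer as ℤ using (ℤ; +_; -_; 0ℤ; 1ℤ; _+_; _*_; +≤+)
open import Data.Integer.Properties as ℤ using ()
open import Algebra.Properties.AbelianGroup ℤ.+-0-abelianGroup using (∙-cancelˡ; ∙-cancelʳ)
open import Algebra.Properties.Semiring.Sum ℤ.+-*-semiring
  using (sum; sum-syntax; ∑-comm; ∑-distrib-+; *-distribˡ-sum; *-distribʳ-sum; sum-cong-≗; sum-replicate-zero)
open import Data.Integer.Tactic.RingSolver using (solve-∀)
open import Data.List using ([]; _∷_; length; filterᵇ; allFin; tabulate)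
open import Data.List.Membership.Propositional using (_∈_)
open import Data.List.Membership.Propositional.Properties using (∈-allFin)
open import Data.List.Relation.Unary.Any using (here; there)
open import Data.Nat as ℕ using (ℕ; zero; suc; _≤_; _≤ᵇ_; z≤n; s≤s)
open import Data.Nat.Properties using (+-comm; ≤-refl; ≤ᵇ⇒≤; ≤⇒≤ᵇ; m+n≡0⇒m≡0; m+n≡0⇒n≡0)
open import Data.Product using (∃; ∃₂; _×_; _,_; proj₁; proj₂)
open import Data.Sum using (_⊎_; inj₁; inj₂)
open import Data.Unit using (tt)
open import Data.Vec using (Vec; _∷_; []; lookup)
open import Function using (_∘_)
open import Relation.Binary.PropositionalEquality
  using (_≡_; _≢_; refl; sym; trans; cong; cong₂; subst; module ≡-Reasoning)
open import Relation.Nullary using (yes; no; ¬_)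
open import Relation.Nullary.Decidable using (⌊_⌋; from-yes)

∨-true : ∀ {a b} → a ∨ b ≡ true → a ≡ true ⊎ b ≡ true
∨-true {true}  _ = inj₁ refl
∨-true {false} e = inj₂ e

∧-true : ∀ {a b} → a ∧ b ≡ true → a ≡ true × b ≡ true
∧-true {true} {true} _ = refl , refl

T⇒true : ∀ {b} → T b → b ≡ true
T⇒true {true} _ = refl

any-true : ∀ {A : Set} (P : A → Bool) xs → any P xs ≡ true → ∃ λ x → P x ≡ true
any-true P (x ∷ xs) e with P x in Px
... | true  = x , Px
... | false = any-true P xs e

any-intro : ∀ {A : Set} (P : A → Bool) {xs x} → x ∈ xs → P x ≡ true → any P xs ≡ true
any-intro P (here refl) Px rewrite Px = refl
any-intro P {y ∷ _} (there x∈xs) Px with P y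
... | true  = refl
... | false = any-intro P x∈xs Px

filter-nonempty : ∀ {A : Set} (P : A → Bool) xs {k} → length (filterᵇ P xs) ≡ suc k → ∃ λ x → P x ≡ true
filter-nonempty P (x ∷ xs) e with P x in Px
... | true  = x , Px
... | false = filter-nonempty P xs e

module Walks {n : ℕ} (G : Graph n) where

  private
    W = within G

  within-refl : ∀ k u → W k u u ≡ true
  within-refl zero u with u ≟ u
  ... | yes _  = refl
  ... | no u≢u = ⊥-elim (u≢u refl)
  within-refl (suc k) u rewrite within-refl k u = refl

  within-suc : ∀ k u v → W k u v ≡ true → W (suc k) u v ≡ true
  within-suc k u v e rewrite e = refl

  within-step : ∀ k u w v → adj G u w ≡ true → W k w v ≡ true → W (suc k) u v ≡ true
  within-step k u w v uw wv with W k u v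
  ... | true  = refl
  ... | false = any-intro (λ x → adj G u x ∧ W k x v) (∈-allFin w)
                  (subst (λ b → b ∧ W k w v ≡ true) (sym uw) wv)

  within-zero : ∀ u v → W 0 u v ≡ true → u ≡ v
  within-zero u v e with u ≟ v
  ... | yes u≡v = u≡v

  within-inv : ∀ k u v → W (suc k) u v ≡ true →
               W k u v ≡ true ⊎ ∃ λ w → adj G u w ≡ true × W k w v ≡ true
  within-inv k u v e with ∨-true {W k u v} e
  ... | inj₁ short = inj₁ short
  ... | inj₂ long with any-true (λ x → adj G u x ∧ W k x v) (allFin n) long
  ...   | w , uwv with adj G u w in uw
  ...     | true = inj₂ (w , uw , uwv)

  within-trans : ∀ a b u w v → W a u w ≡ true → W b w v ≡ true → W (a ℕ.+ b) u v ≡ true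
  within-trans zero    b u w v uw wv rewrite within-zero u w uw = wv
  within-trans (suc a) b u w v uw wv with within-inv a u w uw
  ... | inj₁ short          = within-suc (a ℕ.+ b) u v (within-trans a b u w v short wv)
  ... | inj₂ (x , ux , xw) = within-step (a ℕ.+ b) u x v ux (within-trans a b x w v xw wv)

  within-sym : ∀ k u v → W k u v ≡ true → W k v u ≡ true
  within-sym zero    u v e rewrite within-zero u v e = within-refl 0 v
  within-sym (suc k) u v e with within-inv k u v e
  ... | inj₁ short = within-suc k v u (within-sym k u v short)
  ... | inj₂ (w , uw , wv) =
    subst (λ m → W m v u ≡ true) (+-comm k 1)
      (within-trans k 1 v w u (within-sym k w v wv)
        (within-step 0 w u u (trans (Graph.sym G w u) uw) (within-refl 0 u)))

  within-comm : ∀ k u v → W k u v ≡ W k v u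
  within-comm k u v with W k u v in uv | W k v u in vu
  ... | true  | true  = refl
  ... | false | false = refl
  ... | true  | false = trans (sym (within-sym k u v uv)) vu
  ... | false | true  = sym (trans (sym (within-sym k v u vu)) uv)

  within-mono : ∀ {j k} u v → j ≤ k → W j u v ≡ true → W k u v ≡ true
  within-mono {k = zero}  u v z≤n e = e
  within-mono {k = suc k} u v z≤n e = within-suc k u v (within-mono {k = k} u v z≤n e)
  within-mono {suc j} {suc k} u v (s≤s j≤k) e with within-inv j u v e
  ... | inj₁ short          = within-suc k u v (within-mono u v j≤k short)
  ... | inj₂ (w , uw , wv) = within-step k u w v uw (within-mono w v j≤k wv)

-- A monotone triple of Booleans b₀ → b₁ → b₂ is described by the position of its
-- first `true` (3 if there is none): bₖ holds exactly when that position is ≤ k.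
firstTrue : Bool → Bool → Bool → Fin 4
firstTrue true  _     _     = 0F
firstTrue false true  _     = 1F
firstTrue false false true  = 2F
firstTrue false false false = 3F

firstTrue-≤ᵇ : ∀ b₀ b₁ b₂ → (b₀ ≡ true → b₁ ≡ true) → (b₁ ≡ true → b₂ ≡ true) →
  let d = toℕ (firstTrue b₀ b₁ b₂) in
  (b₀ ≡ (d ≤ᵇ 0)) × (b₁ ≡ (d ≤ᵇ 1)) × (b₂ ≡ (d ≤ᵇ 2))
firstTrue-≤ᵇ true  true  true  _ _ = refl , refl , refl
firstTrue-≤ᵇ false true  true  _ _ = refl , refl , refl
firstTrue-≤ᵇ false false true  _ _ = refl , refl , refl
firstTrue-≤ᵇ false false false _ _ = refl , refl , refl
firstTrue-≤ᵇ true  false _     m _ with m refl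
... | ()
firstTrue-≤ᵇ _     true  false _ m with m refl
... | ()

triangleᵇ : Fin 4 → Fin 4 → Fin 4 → Bool
triangleᵇ h a b = (toℕ h ≤ᵇ toℕ a ℕ.+ toℕ b) ∧ (toℕ a ≤ᵇ toℕ h ℕ.+ toℕ b) ∧ (toℕ b ≤ᵇ toℕ h ℕ.+ toℕ a)

module Distance {n : ℕ} (G : Graph n) (diam : ∀ u v → within G 3 u v ≡ true) where

  open Walks G

  dist : Fin n → Fin n → Fin 4
  dist u v = firstTrue (within G 0 u v) (within G 1 u v) (within G 2 u v)

  within-dist : ∀ k u v → within G k u v ≡ (toℕ (dist u v) ≤ᵇ k)
  within-dist 0 u v = proj₁ (firstTrue-≤ᵇ _ _ _ (within-suc 0 u v) (within-suc 1 u v))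
  within-dist 1 u v = proj₁ (proj₂ (firstTrue-≤ᵇ _ _ _ (within-suc 0 u v) (within-suc 1 u v)))
  within-dist 2 u v = proj₂ (proj₂ (firstTrue-≤ᵇ _ _ _ (within-suc 0 u v) (within-suc 1 u v)))
  within-dist (suc (suc (suc k))) u v =
    trans (within-mono {3} {3 ℕ.+ k} u v (s≤s (s≤s (s≤s z≤n))) (diam u v)) (sym (below-3+ (dist u v)))
    where
      below-3+ : (d : Fin 4) → (toℕ d ≤ᵇ suc (suc (suc k))) ≡ true
      below-3+ 0F = refl
      below-3+ 1F = refl
      below-3+ 2F = refl
      below-3+ 3F = refl

  isDist-dist : ∀ (k : Fin 4) u v → isDist G (toℕ k) u v ≡ ⌊ dist u v ≟ k ⌋
  isDist-dist 0F u v = trans (within-dist 0 u v) (at-zero (dist u v))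
    where
      at-zero : (d : Fin 4) → (toℕ d ≤ᵇ 0) ≡ ⌊ d ≟ 0F ⌋
      at-zero 0F = refl
      at-zero 1F = refl
      at-zero 2F = refl
      at-zero 3F = refl
  isDist-dist (suc k) u v =
    trans (cong₂ (λ a b → a ∧ not b) (within-dist (suc (toℕ k)) u v) (within-dist (toℕ k) u v))
          (exactly (dist u v) k)
    where
      exactly : (d : Fin 4) (k : Fin 3) → ((toℕ d ≤ᵇ suc (toℕ k)) ∧ not (toℕ d ≤ᵇ toℕ k)) ≡ ⌊ d ≟ suc k ⌋
      exactly 0F _  = refl
      exactly 1F 0F = refl
      exactly 1F 1F = refl
      exactly 1F 2F = refl
      exactly 2F 0F = refl
      exactly 2F 1F = refl
      exactly 2F 2F = refl
      exactly 3F 0F = refl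
      exactly 3F 1F = refl
      exactly 3F 2F = refl

  isDist⇒dist : ∀ k u v → isDist G (toℕ k) u v ≡ true → dist u v ≡ k
  isDist⇒dist k u v e with dist u v ≟ k | isDist-dist k u v
  ... | yes d≡k | _ = d≡k
  ... | no _    | e′ with () ← trans (sym e) e′

  dist⇒isDist : ∀ u v → isDist G (toℕ (dist u v)) u v ≡ true
  dist⇒isDist u v with dist u v ≟ dist u v | isDist-dist (dist u v) u v
  ... | yes _ | e = e
  ... | no d≢d | _ = ⊥-elim (d≢d refl)

  dist-refl : ∀ u → dist u u ≡ 0F
  dist-refl u rewrite within-refl 0 u = refl

  dist-sym : ∀ u v → dist u v ≡ dist v u
  dist-sym u v = same-tests (within-comm 0 u v) (within-comm 1 u v) (within-comm 2 u v)
    where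
      same-tests : ∀ {a b c a′ b′ c′} → a ≡ a′ → b ≡ b′ → c ≡ c′ → firstTrue a b c ≡ firstTrue a′ b′ c′
      same-tests refl refl refl = refl

  dist-≤ : ∀ k u v → within G k u v ≡ true → toℕ (dist u v) ≤ k
  dist-≤ k u v e = ≤ᵇ⇒≤ _ k (subst T (trans (sym e) (within-dist k u v)) tt)

  within-at-dist : ∀ u v → within G (toℕ (dist u v)) u v ≡ true
  within-at-dist u v = trans (within-dist _ u v) (T⇒true (≤⇒≤ᵇ (≤-refl {toℕ (dist u v)})))

  dist-triangle : ∀ u w v → toℕ (dist u v) ≤ toℕ (dist u w) ℕ.+ toℕ (dist w v)
  dist-triangle u w v = dist-≤ _ u v
    (within-trans (toℕ (dist u w)) (toℕ (dist w v)) u w v (within-at-dist u w) (within-at-dist w v))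

  dist-triangleᵇ : ∀ u v w → triangleᵇ (dist u v) (dist u w) (dist v w) ≡ true
  dist-triangleᵇ u v w = all-true (T⇒true (≤⇒≤ᵇ uv≤)) (T⇒true (≤⇒≤ᵇ (dist-triangle u v w))) (T⇒true (≤⇒≤ᵇ vw≤))
    where
      all-true : ∀ {a b c} → a ≡ true → b ≡ true → c ≡ true → a ∧ b ∧ c ≡ true
      all-true refl refl refl = refl
      uv≤ : toℕ (dist u v) ≤ toℕ (dist u w) ℕ.+ toℕ (dist v w)
      uv≤ = subst (λ d → toℕ (dist u v) ≤ toℕ (dist u w) ℕ.+ toℕ d) (dist-sym w v) (dist-triangle u w v)
      vw≤ : toℕ (dist v w) ≤ toℕ (dist u v) ℕ.+ toℕ (dist u w)
      vw≤ = subst (λ d → toℕ (dist v w) ≤ toℕ d ℕ.+ toℕ (dist u w)) (dist-sym v u) (dist-triangle v u w)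

δ : ∀ {m} → Fin m → Fin m → ℤ
δ zero    zero    = 1ℤ
δ zero    (suc _) = 0ℤ
δ (suc _) zero    = 0ℤ
δ (suc a) (suc b) = δ a b

δ-sym : ∀ {m} (a b : Fin m) → δ a b ≡ δ b a
δ-sym zero    zero    = refl
δ-sym zero    (suc _) = refl
δ-sym (suc _) zero    = refl
δ-sym (suc a) (suc b) = δ-sym a b

δ-≢ : ∀ {m} {a b : Fin m} → a ≢ b → δ a b ≡ 0ℤ
δ-≢ {a = zero}  {zero}  a≢b = ⊥-elim (a≢b refl)
δ-≢ {a = zero}  {suc _} _   = refl
δ-≢ {a = suc _} {zero}  _   = refl
δ-≢ {a = suc a} {suc b} a≢b = δ-≢ (a≢b ∘ cong suc)

ind : Bool → ℤ
ind true  = 1ℤ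
ind false = 0ℤ

ind-∧ : ∀ a b → ind (a ∧ b) ≡ ind a * ind b
ind-∧ true  true  = refl
ind-∧ true  false = refl
ind-∧ false _     = refl

ind-≟ : ∀ {m} (a b : Fin m) → ind ⌊ a ≟ b ⌋ ≡ δ a b
ind-≟ zero    zero    = refl
ind-≟ zero    (suc _) = refl
ind-≟ (suc _) zero    = refl
ind-≟ (suc a) (suc b) with a ≟ b | ind-≟ a b
... | yes _ | e = e
... | no _  | e = e

∑-δ : ∀ {m} (a : Fin m) (φ : Fin m → ℤ) → ∑[ b < m ] (δ a b * φ b) ≡ φ a
∑-δ {suc m} zero φ = begin
  1ℤ * φ zero + ∑[ b < m ] 0ℤ ≡⟨ cong₂ _+_ (ℤ.*-identityˡ (φ zero)) (sum-replicate-zero m) ⟩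
  φ zero + 0ℤ                 ≡⟨ ℤ.+-identityʳ (φ zero) ⟩
  φ zero                      ∎
  where open ≡-Reasoning
∑-δ {suc m} (suc a) φ = trans (ℤ.+-identityˡ _) (∑-δ a (φ ∘ suc))

∑-δʳ : ∀ {m} (a : Fin m) (φ : Fin m → ℤ) → ∑[ b < m ] (δ b a * φ b) ≡ φ a
∑-δʳ a φ = trans (sum-cong-≗ (λ b → cong (_* φ b) (δ-sym b a))) (∑-δ a φ)

length-filter : ∀ {A : Set} {m} (P : A → Bool) (g : Fin m → A) →
  + length (filterᵇ P (tabulate g)) ≡ ∑[ i < m ] ind (P (g i))
length-filter {m = zero}  P g = refl
length-filter {m = suc m} P g with P (g zero)
... | true  = cong (λ s → 1ℤ + s) (length-filter P (g ∘ suc))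
... | false = trans (length-filter P (g ∘ suc)) (sym (ℤ.+-identityˡ _))

sum-solve : ∀ {m} (f g : Fin m → ℤ) (k : Fin m) →
  (∀ a → a ≢ k → f a ≡ g a) → sum f ≡ sum g → f k ≡ g k
sum-solve {suc m} f g zero others f≡g =
  ∙-cancelʳ (sum (f ∘ suc)) (f zero) (g zero)
    (trans f≡g (cong (λ s → g zero + s) (sym (sum-cong-≗ (λ a → others (suc a) (λ ()))))))
sum-solve {suc m} f g (suc k) others f≡g =
  sum-solve (f ∘ suc) (g ∘ suc) k (λ a a≢k → others (suc a) (a≢k ∘ suc-injective))
    (∙-cancelˡ (g zero) _ _ (trans (cong (_+ sum (f ∘ suc)) (sym (others zero (λ ())))) f≡g))

sum-* : ∀ {m} (a b : Fin m → ℤ) → sum a * sum b ≡ ∑[ i < m ] ∑[ j < m ] (a i * b j)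
sum-* a b = trans (*-distribʳ-sum (sum b) a) (sum-cong-≗ (λ i → *-distribˡ-sum (a i) b))

sum-*-* : ∀ {m} (a b c : Fin m → ℤ) →
  ∑[ i < m ] ∑[ j < m ] ∑[ k < m ] (a i * (b j * c k)) ≡ sum a * (sum b * sum c)
sum-*-* a b c = begin
  ∑[ i < _ ] ∑[ j < _ ] ∑[ k < _ ] (a i * (b j * c k))
    ≡⟨ sum-cong-≗ (λ i → sum-cong-≗ (λ j → *-distribˡ-sum (a i) (λ k → b j * c k))) ⟨
  ∑[ i < _ ] ∑[ j < _ ] (a i * ∑[ k < _ ] (b j * c k))
    ≡⟨ sum-cong-≗ (λ i → *-distribˡ-sum (a i) (λ j → ∑[ k < _ ] (b j * c k))) ⟨
  ∑[ i < _ ] (a i * ∑[ j < _ ] ∑[ k < _ ] (b j * c k))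
    ≡⟨ sum-cong-≗ (λ i → cong (a i *_) (sum-* b c)) ⟨
  ∑[ i < _ ] (a i * (sum b * sum c))
    ≡⟨ *-distribʳ-sum (sum b * sum c) a ⟨
  sum a * (sum b * sum c) ∎
  where open ≡-Reasoning

∑-combination : ∀ {m} (α β γ : ℤ) (a b c d e f : Fin m → ℤ) →
  ∑[ i < m ] (α * a i + (β * b i + (γ * c i + (d i + (e i + f i)))))
    ≡ α * sum a + (β * sum b + (γ * sum c + (sum d + (sum e + sum f))))
∑-combination α β γ a b c d e f =
  trans (∑-distrib-+ (λ i → α * a i) _) (cong₂ _+_ (scaled α a)
  (trans (∑-distrib-+ (λ i → β * b i) _) (cong₂ _+_ (scaled β b)
  (trans (∑-distrib-+ (λ i → γ * c i) _) (cong₂ _+_ (scaled γ c)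
  (trans (∑-distrib-+ d _) (cong (λ s → sum d + s) (∑-distrib-+ e f))))))))
  where
    scaled : ∀ k (g : Fin _ → ℤ) → ∑[ i < _ ] (k * g i) ≡ k * sum g
    scaled k g = sym (*-distribˡ-sum k g)

∑-comm₃ : ∀ {l m k} (f : Fin l → Fin m → Fin k → ℤ) →
  ∑[ i < l ] ∑[ j < m ] ∑[ t < k ] f i j t ≡ ∑[ j < m ] ∑[ t < k ] ∑[ i < l ] f i j t
∑-comm₃ f = trans (∑-comm (λ i j → ∑[ t < _ ] f i j t)) (sum-cong-≗ (λ j → ∑-comm (λ i t → f i j t)))

sum-nonneg : ∀ {m} (f : Fin m → ℤ) → (∀ i → 0ℤ ℤ.≤ f i) → 0ℤ ℤ.≤ sum f
sum-nonneg {zero}  f f≥0 = +≤+ z≤n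
sum-nonneg {suc m} f f≥0 = ℤ.+-mono-≤ (f≥0 zero) (sum-nonneg (f ∘ suc) (f≥0 ∘ suc))

nonneg-+-zero : ∀ {a b} → 0ℤ ℤ.≤ a → 0ℤ ℤ.≤ b → a + b ≡ 0ℤ → a ≡ 0ℤ × b ≡ 0ℤ
nonneg-+-zero {+ a} {+ b} _ _ e =
  cong +_ (m+n≡0⇒m≡0 a (ℤ.+-injective e)) , cong +_ (m+n≡0⇒n≡0 a (ℤ.+-injective e))

sum-nonneg-zero : ∀ {m} (f : Fin m → ℤ) → (∀ i → 0ℤ ℤ.≤ f i) → sum f ≡ 0ℤ → ∀ i → f i ≡ 0ℤ
sum-nonneg-zero {suc m} f f≥0 Σf≡0 i
  with nonneg-+-zero (f≥0 zero) (sum-nonneg (f ∘ suc) (f≥0 ∘ suc)) Σf≡0 | i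
... | f₀≡0 , _      | zero   = f₀≡0
... | _    , rest≡0 | suc i′ = sum-nonneg-zero (f ∘ suc) (f≥0 ∘ suc) rest≡0 i′

square-nonneg : ∀ i → 0ℤ ℤ.≤ i * i
square-nonneg (+ zero)   = +≤+ z≤n
square-nonneg (+ suc _)  = +≤+ z≤n
square-nonneg ℤ.-[1+ _ ] = +≤+ z≤n

square-zero : ∀ i → i * i ≡ 0ℤ → i ≡ 0ℤ
square-zero i e with ℤ.i*j≡0⇒i≡0∨j≡0 i e
... | inj₁ i≡0 = i≡0
... | inj₂ i≡0 = i≡0

module DistanceRegular {n : ℕ} (G : Graph n) (diam : ∀ u v → within G 3 u v ≡ true)
  (p : ℕ → ℕ → ℕ → ℕ)
  (regular : ∀ u v (i j : Fin 4) →
     count G u v (toℕ i) (toℕ j) ≡ p (toℕ (Distance.dist G diam u v)) (toℕ i) (toℕ j)) where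

  open Distance G diam

  P : Fin 4 → Fin 4 → Fin 4 → ℤ
  P h i j = + p (toℕ h) (toℕ i) (toℕ j)

  count-δ : ∀ u v i j → ∑[ w < n ] (δ (dist u w) i * δ (dist v w) j) ≡ P (dist u v) i j
  count-δ u v i j = begin
    ∑[ w < n ] (δ (dist u w) i * δ (dist v w) j)
      ≡⟨ sum-cong-≗ indicator ⟨
    ∑[ w < n ] ind (isDist G (toℕ i) u w ∧ isDist G (toℕ j) v w)
      ≡⟨ length-filter (λ w → isDist G (toℕ i) u w ∧ isDist G (toℕ j) v w) (λ w → w) ⟨
    + count G u v (toℕ i) (toℕ j)
      ≡⟨ cong +_ (regular u v i j) ⟩
    P (dist u v) i j ∎
    where
      open ≡-Reasoning
      at : ∀ k x y → ind (isDist G (toℕ k) x y) ≡ δ (dist x y) k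
      at k x y = trans (cong ind (isDist-dist k x y)) (ind-≟ (dist x y) k)
      indicator : ∀ w → ind (isDist G (toℕ i) u w ∧ isDist G (toℕ j) v w) ≡ δ (dist u w) i * δ (dist v w) j
      indicator w = trans (ind-∧ (isDist G (toℕ i) u w) _) (cong₂ _*_ (at i u w) (at j v w))

  ⟪_⟫ : (Fin 4 → Fin 4 → ℤ) → Fin 4 → ℤ
  ⟪ ψ ⟫ h = ∑[ a < 4 ] ∑[ b < 4 ] (ψ a b * P h a b)

  pair-sum : ∀ (ψ : Fin 4 → Fin 4 → ℤ) u v → ∑[ w < n ] ψ (dist u w) (dist v w) ≡ ⟪ ψ ⟫ (dist u v)
  pair-sum ψ u v = begin
    ∑[ w < n ] ψ (dist u w) (dist v w)
      ≡⟨ sum-cong-≗ (λ w → expand (dist u w) (dist v w)) ⟩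
    ∑[ w < n ] ∑[ a < 4 ] ∑[ b < 4 ] (χ w a b * ψ a b)
      ≡⟨ ∑-comm (λ w a → ∑[ b < 4 ] (χ w a b * ψ a b)) ⟩
    ∑[ a < 4 ] ∑[ w < n ] ∑[ b < 4 ] (χ w a b * ψ a b)
      ≡⟨ sum-cong-≗ (λ a → ∑-comm (λ w b → χ w a b * ψ a b)) ⟩
    ∑[ a < 4 ] ∑[ b < 4 ] ∑[ w < n ] (χ w a b * ψ a b)
      ≡⟨ sum-cong-≗ (λ a → sum-cong-≗ (λ b → counted a b)) ⟩
    ⟪ ψ ⟫ (dist u v) ∎
    where
      open ≡-Reasoning
      χ : Fin n → Fin 4 → Fin 4 → ℤ
      χ w a b = δ (dist u w) a * δ (dist v w) b
      expand : ∀ x y → ψ x y ≡ ∑[ a < 4 ] ∑[ b < 4 ] (δ x a * δ y b * ψ a b)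
      expand x y = sym (begin
        ∑[ a < 4 ] ∑[ b < 4 ] (δ x a * δ y b * ψ a b)
          ≡⟨ sum-cong-≗ (λ a → sum-cong-≗ (λ b → ℤ.*-assoc (δ x a) (δ y b) (ψ a b))) ⟩
        ∑[ a < 4 ] ∑[ b < 4 ] (δ x a * (δ y b * ψ a b))
          ≡⟨ sum-cong-≗ (λ a → *-distribˡ-sum (δ x a) (λ b → δ y b * ψ a b)) ⟨
        ∑[ a < 4 ] (δ x a * ∑[ b < 4 ] (δ y b * ψ a b))
          ≡⟨ sum-cong-≗ (λ a → cong (δ x a *_) (∑-δ y (ψ a))) ⟩
        ∑[ a < 4 ] (δ x a * ψ a y)
          ≡⟨ ∑-δ x (λ a → ψ a y) ⟩
        ψ x y ∎)
      counted : ∀ a b → ∑[ w < n ] (χ w a b * ψ a b) ≡ ψ a b * P (dist u v) a b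
      counted a b = begin
        ∑[ w < n ] (χ w a b * ψ a b) ≡⟨ *-distribʳ-sum (ψ a b) (λ w → χ w a b) ⟨
        ∑[ w < n ] χ w a b * ψ a b   ≡⟨ cong (_* ψ a b) (count-δ u v a b) ⟩
        P (dist u v) a b * ψ a b     ≡⟨ ℤ.*-comm _ (ψ a b) ⟩
        ψ a b * P (dist u v) a b     ∎

  row-sum : ∀ u v i → ∑[ j < 4 ] P (dist u v) i j ≡ ∑[ w < n ] δ (dist u w) i
  row-sum u v i = sym (begin
    ∑[ w < n ] δ (dist u w) i
      ≡⟨ pair-sum (λ a _ → δ a i) u v ⟩
    ∑[ a < 4 ] ∑[ b < 4 ] (δ a i * P h a b)
      ≡⟨ sum-cong-≗ (λ a → *-distribˡ-sum (δ a i) (P h a)) ⟨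
    ∑[ a < 4 ] (δ a i * ∑[ b < 4 ] P h a b)
      ≡⟨ ∑-δʳ i (λ a → ∑[ b < 4 ] P h a b) ⟩
    ∑[ j < 4 ] P h i j ∎)
    where
      open ≡-Reasoning
      h = dist u v

  row-sum-invariant : ∀ u v i → ∑[ j < 4 ] P (dist u v) i j ≡ ∑[ j < 4 ] P 0F i j
  row-sum-invariant u v i =
    trans (row-sum u v i) (trans (sym (row-sum u u i)) (cong (λ h → ∑[ j < 4 ] P h i j) (dist-refl u)))

  -- p^h_{0j} = δ_{hj}: the only vertex at distance 0 from u is u itself
  P-zero : ∀ u v j → P (dist u v) 0F j ≡ δ (dist u v) j
  P-zero u v j = begin
    P (dist u v) 0F j                          ≡⟨ count-δ u v 0F j ⟨
    ∑[ w < n ] (δ (dist u w) 0F * δ (dist v w) j) ≡⟨ sum-cong-≗ (λ w → cong (_* δ (dist v w) j) (at-zero w)) ⟩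
    ∑[ w < n ] (δ u w * δ (dist v w) j)           ≡⟨ ∑-δ u (λ w → δ (dist v w) j) ⟩
    δ (dist v u) j                              ≡⟨ cong (λ h → δ h j) (dist-sym v u) ⟩
    δ (dist u v) j                              ∎
    where
      open ≡-Reasoning
      at-zero : ∀ w → δ (dist u w) 0F ≡ δ u w
      at-zero w = trans (sym (ind-≟ (dist u w) 0F)) (trans (cong ind (sym (isDist-dist 0F u w))) (ind-≟ u w))

  P-triangle : ∀ u v i j → triangleᵇ (dist u v) i j ≡ false → P (dist u v) i j ≡ 0ℤ
  P-triangle u v i j violated = begin
    P (dist u v) i j                              ≡⟨ count-δ u v i j ⟨
    ∑[ w < n ] (δ (dist u w) i * δ (dist v w) j) ≡⟨ sum-cong-≗ term-zero ⟩
    ∑[ w < n ] 0ℤ                                 ≡⟨ sum-replicate-zero n ⟩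
    0ℤ                                            ∎
    where
      open ≡-Reasoning
      term-zero : ∀ w → δ (dist u w) i * δ (dist v w) j ≡ 0ℤ
      term-zero w with dist u w ≟ i | dist v w ≟ j
      ... | yes refl | yes refl with trans (sym (dist-triangleᵇ u v w)) violated
      ...   | ()
      term-zero w | no uw≢i | _ = cong (_* δ (dist v w) j) (δ-≢ uw≢i)
      term-zero w | yes _ | no vw≢j = trans (cong (δ (dist u w) i *_) (δ-≢ vw≢j)) (ℤ.*-zeroʳ (δ (dist u w) i))

  witness : ∀ u v i j {k} → p (toℕ (dist u v)) (toℕ i) (toℕ j) ≡ suc k →
            ∃ λ w → dist u w ≡ i × dist v w ≡ j
  witness u v i j e with filter-nonempty (λ w → isDist G (toℕ i) u w ∧ isDist G (toℕ j) v w) (allFin n)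
                           (trans (regular u v i j) e)
  ... | w , found with ∧-true {isDist G (toℕ i) u w} found
  ...   | at-i , at-j = w , isDist⇒dist i u w at-i , isDist⇒dist j v w at-j

  -- when d(u,v) = 3 and p^3_{12} ≠ 0, a vertex adjacent to u at distance 2 from v shows
  -- that every distance 0, …, 3 occurs
  distances-occur : ∀ u v {k} → dist u v ≡ 3F → p 3 1 2 ≡ suc k → ∀ h → ∃₂ λ x y → dist x y ≡ h
  distances-occur u v uv p³₁₂ h with witness u v 1F 2F (trans (cong (λ d → p (toℕ d) 1 2) uv) p³₁₂)
  distances-occur u v uv p³₁₂ 0F | _ = u , u , dist-refl u
  distances-occur u v uv p³₁₂ 1F | w , uw , _ = u , w , uw
  distances-occur u v uv p³₁₂ 2F | w , _ , vw = v , w , vw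
  distances-occur u v uv p³₁₂ 3F | _ = u , v , uv

  -- Counting the paths u –l– x –i– w –j– v by their first or by their last vertex gives
  -- the associativity  ∑_a p^a_{li} p^h_{aj} = ∑_b p^h_{lb} p^b_{ij}  (h = d(u,v)).
  assoc : ∀ u v l i j →
    ∑[ a < 4 ] (P a l i * P (dist u v) a j) ≡ ∑[ b < 4 ] (P (dist u v) l b * P b i j)
  assoc u v l i j = trans (sym by-last) by-first
    where
      open ≡-Reasoning
      h = dist u v

      paths : ℤ
      paths = ∑[ x < n ] ∑[ w < n ] (δ (dist u x) l * (δ (dist x w) i * δ (dist v w) j))

      by-first : paths ≡ ∑[ b < 4 ] (P h l b * P b i j)
      by-first = begin
        paths
          ≡⟨ sum-cong-≗ (λ x → *-distribˡ-sum (δ (dist u x) l) (λ w → δ (dist x w) i * δ (dist v w) j)) ⟨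
        ∑[ x < n ] (δ (dist u x) l * ∑[ w < n ] (δ (dist x w) i * δ (dist v w) j))
          ≡⟨ sum-cong-≗ (λ x → cong (δ (dist u x) l *_)
               (trans (count-δ x v i j) (cong (λ d → P d i j) (dist-sym x v)))) ⟩
        ∑[ x < n ] (δ (dist u x) l * P (dist v x) i j)
          ≡⟨ pair-sum (λ a b → δ a l * P b i j) u v ⟩
        ∑[ a < 4 ] ∑[ b < 4 ] (δ a l * P b i j * P h a b)
          ≡⟨ sum-cong-≗ (λ a → trans (sum-cong-≗ (λ b → ℤ.*-assoc (δ a l) (P b i j) (P h a b)))
                                    (sym (*-distribˡ-sum (δ a l) (λ b → P b i j * P h a b)))) ⟩
        ∑[ a < 4 ] (δ a l * ∑[ b < 4 ] (P b i j * P h a b))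
          ≡⟨ ∑-δʳ l (λ a → ∑[ b < 4 ] (P b i j * P h a b)) ⟩
        ∑[ b < 4 ] (P b i j * P h l b)
          ≡⟨ sum-cong-≗ (λ b → ℤ.*-comm (P b i j) (P h l b)) ⟩
        ∑[ b < 4 ] (P h l b * P b i j) ∎

      regroup : ∀ w x → δ (dist u x) l * (δ (dist x w) i * δ (dist v w) j)
                      ≡ δ (dist u x) l * δ (dist w x) i * δ (dist v w) j
      regroup w x = trans (sym (ℤ.*-assoc (δ (dist u x) l) _ _))
                          (cong (λ d → δ (dist u x) l * δ d i * δ (dist v w) j) (dist-sym x w))

      by-last : paths ≡ ∑[ a < 4 ] (P a l i * P h a j)
      by-last = begin
        paths
          ≡⟨ ∑-comm (λ x w → δ (dist u x) l * (δ (dist x w) i * δ (dist v w) j)) ⟩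
        ∑[ w < n ] ∑[ x < n ] (δ (dist u x) l * (δ (dist x w) i * δ (dist v w) j))
          ≡⟨ sum-cong-≗ (λ w → sum-cong-≗ (regroup w)) ⟩
        ∑[ w < n ] ∑[ x < n ] (δ (dist u x) l * δ (dist w x) i * δ (dist v w) j)
          ≡⟨ sum-cong-≗ (λ w → *-distribʳ-sum (δ (dist v w) j) (λ x → δ (dist u x) l * δ (dist w x) i)) ⟨
        ∑[ w < n ] (∑[ x < n ] (δ (dist u x) l * δ (dist w x) i) * δ (dist v w) j)
          ≡⟨ sum-cong-≗ (λ w → cong (_* δ (dist v w) j) (count-δ u w l i)) ⟩
        ∑[ w < n ] (P (dist u w) l i * δ (dist v w) j)
          ≡⟨ pair-sum (λ a b → P a l i * δ b j) u v ⟩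
        ∑[ a < 4 ] ∑[ b < 4 ] (P a l i * δ b j * P h a b)
          ≡⟨ sum-cong-≗ (λ a → trans (sum-cong-≗ (λ b → ℤ.*-assoc (P a l i) (δ b j) (P h a b)))
                            (trans (sym (*-distribˡ-sum (P a l i) (λ b → δ b j * P h a b)))
                                   (cong (P a l i *_) (∑-δʳ j (P h a))))) ⟩
        ∑[ a < 4 ] (P a l i * P h a j) ∎

  Φ : (Fin 4 → ℤ) → Fin 4 → ℤ
  Φ φ = ⟪ (λ a b → φ a * φ b) ⟫

  Φ-sum : ∀ φ w w′ → ∑[ x < n ] (φ (dist x w) * φ (dist x w′)) ≡ Φ φ (dist w w′)
  Φ-sum φ w w′ = trans (sum-cong-≗ (λ x → cong₂ (λ a b → φ a * φ b) (dist-sym x w) (dist-sym x w′)))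
                       (pair-sum (λ a b → φ a * φ b) w w′)

  triple : (f g : Fin 4 → ℤ) → Fin n → Fin n → Fin n → ℤ
  triple f g x y z = ∑[ w < n ] (f (dist x w) * (g (dist y w) * g (dist z w)))

  sum-of-squares : ∀ f g →
    ∑[ x < n ] ∑[ y < n ] ∑[ z < n ] (triple f g x y z * triple f g x y z)
      ≡ ∑[ w < n ] ∑[ w′ < n ] (Φ f (dist w w′) * (Φ g (dist w w′) * Φ g (dist w w′)))
  sum-of-squares f g = begin
    ∑[ x < n ] ∑[ y < n ] ∑[ z < n ] (triple f g x y z * triple f g x y z)
      ≡⟨ sum-cong-≗ (λ x → sum-cong-≗ (λ y → sum-cong-≗ (λ z →
           trans (sum-* (t x y z) (t x y z)) (sum-cong-≗ (λ w → sum-cong-≗ (λ w′ → regroup x y z w w′)))))) ⟩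
    ∑[ x < n ] ∑[ y < n ] ∑[ z < n ] ∑[ w < n ] ∑[ w′ < n ] H x y z w w′
      ≡⟨ sum-cong-≗ (λ x → sum-cong-≗ (λ y → ∑-comm₃ (H x y))) ⟩
    ∑[ x < n ] ∑[ y < n ] ∑[ w < n ] ∑[ w′ < n ] ∑[ z < n ] H x y z w w′
      ≡⟨ sum-cong-≗ (λ x → ∑-comm₃ (λ y w w′ → ∑[ z < n ] H x y z w w′)) ⟩
    ∑[ x < n ] ∑[ w < n ] ∑[ w′ < n ] ∑[ y < n ] ∑[ z < n ] H x y z w w′
      ≡⟨ ∑-comm₃ (λ x w w′ → ∑[ y < n ] ∑[ z < n ] H x y z w w′) ⟩
    ∑[ w < n ] ∑[ w′ < n ] ∑[ x < n ] ∑[ y < n ] ∑[ z < n ] H x y z w w′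
      ≡⟨ sum-cong-≗ (λ w → sum-cong-≗ (λ w′ →
           trans (sum-*-* (λ x → f (dist x w) * f (dist x w′)) (λ y → g (dist y w) * g (dist y w′))
                          (λ z → g (dist z w) * g (dist z w′)))
                 (cong₂ (λ s r → s * (r * r)) (Φ-sum f w w′) (Φ-sum g w w′)))) ⟩
    ∑[ w < n ] ∑[ w′ < n ] (Φ f (dist w w′) * (Φ g (dist w w′) * Φ g (dist w w′))) ∎
    where
      open ≡-Reasoning
      t : Fin n → Fin n → Fin n → Fin n → ℤ
      t x y z w = f (dist x w) * (g (dist y w) * g (dist z w))
      H : Fin n → Fin n → Fin n → Fin n → Fin n → ℤ
      H x y z w w′ = (f (dist x w) * f (dist x w′)) * ((g (dist y w) * g (dist y w′)) * (g (dist z w) * g (dist z w′)))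
      rearrange : ∀ a b c d e f → (a * (b * c)) * (d * (e * f)) ≡ (a * d) * ((b * e) * (c * f))
      rearrange = solve-∀
      regroup : ∀ x y z w w′ → t x y z w * t x y z w′ ≡ H x y z w w′
      regroup x y z w w′ = rearrange (f (dist x w)) (g (dist y w)) (g (dist z w)) (f (dist x w′)) (g (dist y w′)) (g (dist z w′))

  -- If  ∑_h k_h Φ_f(h) Φ_g(h)²  vanishes (this is, up to a positive factor, a Krein
  -- parameter of the graph), then every triple sum T(x,y,z) vanishes.
  krein-vanishing : ∀ f g → ⟪ (λ a _ → Φ f a * (Φ g a * Φ g a)) ⟫ 0F ≡ 0ℤ →
                    ∀ x y z → triple f g x y z ≡ 0ℤ
  krein-vanishing f g krein x y z =
    square-zero (t x y z) (sum-nonneg-zero (λ z → sq x y z) (λ z → square-nonneg (t x y z))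
      (sum-nonneg-zero (λ y → ∑[ z < n ] sq x y z) (λ y → nonneg₁ x y)
        (sum-nonneg-zero (λ x → ∑[ y < n ] ∑[ z < n ] sq x y z) (λ x → sum-nonneg _ (nonneg₁ x))
          (trans (sum-of-squares f g) rows-vanish) x) y) z)
    where
      t : Fin n → Fin n → Fin n → ℤ
      t = triple f g
      sq : Fin n → Fin n → Fin n → ℤ
      sq x y z = t x y z * t x y z
      nonneg₁ : ∀ x y → 0ℤ ℤ.≤ ∑[ z < n ] sq x y z
      nonneg₁ x y = sum-nonneg _ (λ z → square-nonneg (t x y z))
      χ : Fin 4 → ℤ
      χ a = Φ f a * (Φ g a * Φ g a)
      rows-vanish : ∑[ w < n ] ∑[ w′ < n ] χ (dist w w′) ≡ 0ℤ
      rows-vanish = trans (sum-cong-≗ (λ w → trans (pair-sum (λ a _ → χ a) w w)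
                                         (trans (cong ⟪ (λ a _ → χ a) ⟫ (dist-refl w)) krein)))
                          (sum-replicate-zero n)

-- The intersection numbers p^h_{ij} of the array {234,165,12;1,30,198}, listed as the
-- four 4×4 matrices (p^h_{ij})_{ij} for h = 0, 1, 2, 3.
intersection : Fin 4 → Fin 4 → Fin 4 → ℕ
intersection h i j = lookup (lookup (lookup table h) i) j
  where
    table : Vec (Vec (Vec ℕ 4) 4) 4
    table = ((1 ∷ 0 ∷ 0 ∷ 0 ∷ []) ∷ (0 ∷ 234 ∷ 0 ∷ 0 ∷ []) ∷ (0 ∷ 0 ∷ 1287 ∷ 0 ∷ []) ∷ (0 ∷ 0 ∷ 0 ∷ 78 ∷ []) ∷ [])
          ∷ ((0 ∷ 1 ∷ 0 ∷ 0 ∷ []) ∷ (1 ∷ 68 ∷ 165 ∷ 0 ∷ []) ∷ (0 ∷ 165 ∷ 1056 ∷ 66 ∷ []) ∷ (0 ∷ 0 ∷ 66 ∷ 12 ∷ []) ∷ [])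
          ∷ ((0 ∷ 0 ∷ 1 ∷ 0 ∷ []) ∷ (0 ∷ 30 ∷ 192 ∷ 12 ∷ []) ∷ (1 ∷ 192 ∷ 1030 ∷ 64 ∷ []) ∷ (0 ∷ 12 ∷ 64 ∷ 2 ∷ []) ∷ [])
          ∷ ((0 ∷ 0 ∷ 0 ∷ 1 ∷ []) ∷ (0 ∷ 0 ∷ 198 ∷ 36 ∷ []) ∷ (0 ∷ 198 ∷ 1056 ∷ 33 ∷ []) ∷ (1 ∷ 36 ∷ 33 ∷ 8 ∷ []) ∷ [])
          ∷ []

Pᵗ : Fin 4 → Fin 4 → Fin 4 → ℤ
Pᵗ h i j = + intersection h i j

Pᵗ-zero : ∀ h j → δ h j ≡ Pᵗ h 0F j
Pᵗ-zero = from-yes (all? λ h → all? λ j → δ h j ℤ.≟ Pᵗ h 0F j)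

Pᵗ-recurrence : ∀ i h j → ∑[ b < 4 ] (Pᵗ h 1F b * Pᵗ b i j) ≡ ∑[ a < 4 ] (Pᵗ a 1F i * Pᵗ h a j)
Pᵗ-recurrence = from-yes (all? λ i → all? λ h → all? λ j →
                 ∑[ b < 4 ] (Pᵗ h 1F b * Pᵗ b i j) ℤ.≟ ∑[ a < 4 ] (Pᵗ a 1F i * Pᵗ h a j))

⟪_⟫ᵗ : (Fin 4 → Fin 4 → ℤ) → Fin 4 → ℤ
⟪ ψ ⟫ᵗ h = ∑[ a < 4 ] ∑[ b < 4 ] (ψ a b * Pᵗ h a b)

Φᵗ : (Fin 4 → ℤ) → Fin 4 → ℤ
Φᵗ φ = ⟪ (λ a b → φ a * φ b) ⟫ᵗ

-- (multiples of) the standard sequences of the eigenvalues 54 and 14: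
-- u₀ = 1, u₁ = θ/k and θ uᵢ = cᵢ uᵢ₋₁ + aᵢ uᵢ + bᵢ uᵢ₊₁
u₅₄ u₁₄ : Fin 4 → ℤ
u₅₄ = lookup (+ 39 ∷ + 9 ∷ - + 1 ∷ - + 11 ∷ [])
u₁₄ = lookup (+ 117 ∷ + 7 ∷ - + 3 ∷ + 27 ∷ [])

-- the Krein parameter q^{54}_{14,14} vanishes:  ∑_h k_h Φ_{54}(h) Φ_{14}(h)² = 0
krein-zero : ⟪ (λ a _ → Φᵗ u₅₄ a * (Φᵗ u₁₄ a * Φᵗ u₁₄ a)) ⟫ᵗ 0F ≡ 0ℤ
krein-zero = refl

-- A function of three distances that is nonnegative everywhere, but whose sum over
-- the vertices w, for three vertices mutually at distance 3, is negative once the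
-- triple sums of u₅₄ ⊗ u₁₄ ⊗ u₁₄ vanish:
--   Λ(r,s,t) = −2 f(r)g(s)g(t) − f(s)g(r)g(t) − f(t)g(r)g(s) + μ₁(r,s) + μ₂(r,t) + μ₃(s,t)
μ₁ μ₂ μ₃ : Fin 4 → Fin 4 → ℤ
μ₁ r s = lookup (lookup rows r) s
  where
    rows : Vec (Vec ℤ 4) 4
    rows = (+ 10000000 ∷ + 10000000 ∷ + 0        ∷ - + 12636 ∷ [])
         ∷ (+ 10000000 ∷ + 10000000 ∷ - + 3360   ∷ + 8964    ∷ [])
         ∷ (+ 10000000 ∷ - + 1200   ∷ - + 1800   ∷ + 12324   ∷ [])
         ∷ (+ 0        ∷ + 0        ∷ + 0        ∷ + 15924   ∷ [])
         ∷ []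
μ₂ r t = lookup (lookup rows r) t
  where
    rows : Vec (Vec ℤ 4) 4
    rows = (+ 10000000 ∷ + 10000000 ∷ + 10000000 ∷ + 0 ∷ [])
         ∷ (+ 10000000 ∷ + 0        ∷ - + 10380  ∷ + 0 ∷ [])
         ∷ (+ 10000000 ∷ - + 13200  ∷ - + 12180  ∷ + 0 ∷ [])
         ∷ (- + 91740  ∷ - + 15600  ∷ - + 13980  ∷ + 0 ∷ [])
         ∷ []
μ₃ s t = lookup (lookup rows s) t
  where
    rows : Vec (Vec ℤ 4) 4
    rows = (+ 10000000 ∷ + 10000000 ∷ + 10000000 ∷ - + 75816 ∷ [])
         ∷ (+ 10000000 ∷ + 10000000 ∷ + 13524    ∷ + 324     ∷ [])
         ∷ (+ 10000000 ∷ + 15144    ∷ + 13944    ∷ + 1944    ∷ [])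
         ∷ (+ 0        ∷ + 0        ∷ + 0        ∷ + 0       ∷ [])
         ∷ []

Λ : Fin 4 → Fin 4 → Fin 4 → ℤ
Λ r s t = - + 2 * (u₅₄ r * (u₁₄ s * u₁₄ t)) + (- + 1 * (u₅₄ s * (u₁₄ r * u₁₄ t))
        + (- + 1 * (u₅₄ t * (u₁₄ r * u₁₄ s)) + (μ₁ r s + (μ₂ r t + μ₃ s t))))

Λ-nonneg : ∀ r s t → 0ℤ ℤ.≤ Λ r s t
Λ-nonneg = from-yes (all? λ r → all? λ s → all? λ t → 0ℤ ℤ.≤? Λ r s t)

certificate-negative : ⟪ μ₁ ⟫ᵗ 3F + (⟪ μ₂ ⟫ᵗ 3F + ⟪ μ₃ ⟫ᵗ 3F) ≡ - + 204000
certificate-negative = refl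

module GraphWithArray {n : ℕ} (G : Graph n) (diam : ∀ u v → within G 3 u v ≡ true)
  (p : ℕ → ℕ → ℕ → ℕ)
  (regular : ∀ u v (i j : Fin 4) →
     count G u v (toℕ i) (toℕ j) ≡ p (toℕ (Distance.dist G diam u v)) (toℕ i) (toℕ j))
  (realised : ∀ h → ∃₂ λ u v → Distance.dist G diam u v ≡ h)
  (b₀ : p 0 1 1 ≡ 234) (b₁ : p 1 1 2 ≡ 165) (b₂ : p 2 1 3 ≡ 12)
  (c₁ : p 1 1 0 ≡ 1) (c₂ : p 2 1 1 ≡ 30) (c₃ : p 3 1 2 ≡ 198) where

  open Distance G diam
  open DistanceRegular G diam p regular

  everywhere : (Q : Fin 4 → Set) → (∀ u v → Q (dist u v)) → ∀ h → Q h
  everywhere Q q h with realised h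
  ... | u , v , refl = q u v

  zero-at : ∀ h i j → triangleᵇ h i j ≡ false → P h i j ≡ 0ℤ
  zero-at h i j = everywhere (λ h → triangleᵇ h i j ≡ false → P h i j ≡ 0ℤ) (λ u v → P-triangle u v i j) h

  assoc-at : ∀ h l i j → ∑[ a < 4 ] (P a l i * P h a j) ≡ ∑[ b < 4 ] (P h l b * P b i j)
  assoc-at h l i j = everywhere (λ h → ∑[ a < 4 ] (P a l i * P h a j) ≡ ∑[ b < 4 ] (P h l b * P b i j))
                                (λ u v → assoc u v l i j) h

  level₀ : ∀ h j → P h 0F j ≡ Pᵗ h 0F j
  level₀ h j = trans (everywhere (λ h → P h 0F j ≡ δ h j) (λ u v → P-zero u v j) h) (Pᵗ-zero h j)

  level₁-off : ∀ h j → j ≢ h → P h 1F j ≡ Pᵗ h 1F j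
  level₁-off 0F 0F ne = ⊥-elim (ne refl)
  level₁-off 0F 1F _  = cong +_ b₀
  level₁-off 0F 2F _  = zero-at 0F 1F 2F refl
  level₁-off 0F 3F _  = zero-at 0F 1F 3F refl
  level₁-off 1F 0F _  = cong +_ c₁
  level₁-off 1F 1F ne = ⊥-elim (ne refl)
  level₁-off 1F 2F _  = cong +_ b₁
  level₁-off 1F 3F _  = zero-at 1F 1F 3F refl
  level₁-off 2F 0F _  = zero-at 2F 1F 0F refl
  level₁-off 2F 1F _  = cong +_ c₂
  level₁-off 2F 2F ne = ⊥-elim (ne refl)
  level₁-off 2F 3F _  = cong +_ b₂
  level₁-off 3F 0F _  = zero-at 3F 1F 0F refl
  level₁-off 3F 1F _  = zero-at 3F 1F 1F refl
  level₁-off 3F 2F _  = cong +_ c₃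
  level₁-off 3F 3F ne = ⊥-elim (ne refl)

  row₀ : ∑[ j < 4 ] P 0F 1F j ≡ ∑[ j < 4 ] Pᵗ 0F 1F j
  row₀ = sum-cong-≗ entry
    where
      entry : ∀ j → P 0F 1F j ≡ Pᵗ 0F 1F j
      entry 0F = zero-at 0F 1F 0F refl
      entry 1F = level₁-off 0F 1F (λ ())
      entry 2F = level₁-off 0F 2F (λ ())
      entry 3F = level₁-off 0F 3F (λ ())

  -- the diagonal  a_h = k − b_h − c_h,  from the row sums  ∑_j p^h_{1j} = k
  diagonal : ∀ h → ∑[ j < 4 ] Pᵗ 0F 1F j ≡ ∑[ j < 4 ] Pᵗ h 1F j → P h 1F h ≡ Pᵗ h 1F h
  diagonal h same-valency = sum-solve (P h 1F) (Pᵗ h 1F) h (level₁-off h)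
    (trans (everywhere (λ h → ∑[ j < 4 ] P h 1F j ≡ ∑[ j < 4 ] P 0F 1F j) (λ u v → row-sum-invariant u v 1F) h)
           (trans row₀ same-valency))

  level₁ : ∀ h j → P h 1F j ≡ Pᵗ h 1F j
  level₁ h j with j ≟ h
  ... | no j≢h = level₁-off h j j≢h
  level₁ 0F _ | yes refl = zero-at 0F 1F 0F refl
  level₁ 1F _ | yes refl = diagonal 1F refl
  level₁ 2F _ | yes refl = diagonal 2F refl
  level₁ 3F _ | yes refl = diagonal 3F refl

  -- row i+1 from rows ≤ i, by the recurrence (associativity with l = 1):
  --   p^{i+1}_{1i} p^h_{i+1,j} = ∑_b p^h_{1b} p^b_{ij} − ∑_{a ≠ i+1} p^a_{1i} p^h_{aj}
  next-row : ∀ i h j → (∀ a → a ≢ suc i → P a 1F (inject₁ i) * P h a j ≡ Pᵗ a 1F (inject₁ i) * Pᵗ h a j) →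
             (∀ b → P b (inject₁ i) j ≡ Pᵗ b (inject₁ i) j) →
             P (suc i) 1F (inject₁ i) * P h (suc i) j ≡ Pᵗ (suc i) 1F (inject₁ i) * Pᵗ h (suc i) j
  next-row i h j others row-i = sum-solve _ _ (suc i) others (begin
    ∑[ a < 4 ] (P a 1F (inject₁ i) * P h a j)     ≡⟨ assoc-at h 1F (inject₁ i) j ⟩
    ∑[ b < 4 ] (P h 1F b * P b (inject₁ i) j)     ≡⟨ sum-cong-≗ (λ b → cong₂ _*_ (level₁ h b) (row-i b)) ⟩
    ∑[ b < 4 ] (Pᵗ h 1F b * Pᵗ b (inject₁ i) j)     ≡⟨ Pᵗ-recurrence (inject₁ i) h j ⟩
    ∑[ a < 4 ] (Pᵗ a 1F (inject₁ i) * Pᵗ h a j)     ∎)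
    where open ≡-Reasoning

  -- row 2, dividing by c₂ = 30
  level₂ : ∀ h j → P h 2F j ≡ Pᵗ h 2F j
  level₂ h j = ℤ.*-cancelˡ-≡ (+ 30) _ _
    (trans (cong (_* P h 2F j) (sym (level₁ 2F 1F))) (next-row 1F h j others (λ b → level₁ b j)))
    where
      others : ∀ a → a ≢ 2F → P a 1F 1F * P h a j ≡ Pᵗ a 1F 1F * Pᵗ h a j
      others 0F _  = cong₂ _*_ (level₁ 0F 1F) (level₀ h j)
      others 1F _  = cong₂ _*_ (level₁ 1F 1F) (level₁ h j)
      others 2F ne = ⊥-elim (ne refl)
      others 3F _  = cong (_* P h 3F j) (level₁ 3F 1F)

  -- row 3, dividing by c₃ = 198
  level₃ : ∀ h j → P h 3F j ≡ Pᵗ h 3F j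
  level₃ h j = ℤ.*-cancelˡ-≡ (+ 198) _ _
    (trans (cong (_* P h 3F j) (sym (level₁ 3F 2F))) (next-row 2F h j others (λ b → level₂ b j)))
    where
      others : ∀ a → a ≢ 3F → P a 1F 2F * P h a j ≡ Pᵗ a 1F 2F * Pᵗ h a j
      others 0F _  = cong₂ _*_ (level₁ 0F 2F) (level₀ h j)
      others 1F _  = cong₂ _*_ (level₁ 1F 2F) (level₁ h j)
      others 2F _  = cong₂ _*_ (level₁ 2F 2F) (level₂ h j)
      others 3F ne = ⊥-elim (ne refl)

  intersection-numbers : ∀ h i j → P h i j ≡ Pᵗ h i j
  intersection-numbers h 0F = level₀ h
  intersection-numbers h 1F = level₁ h
  intersection-numbers h 2F = level₂ h
  intersection-numbers h 3F = level₃ h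

  pair-sum-table : ∀ ψ ψ′ → (∀ a b → ψ a b ≡ ψ′ a b) → ∀ h → ⟪ ψ ⟫ h ≡ ⟪ ψ′ ⟫ᵗ h
  pair-sum-table _ _ ψ≡ψ′ h =
    sum-cong-≗ (λ a → sum-cong-≗ (λ b → cong₂ _*_ (ψ≡ψ′ a b) (intersection-numbers h a b)))

  triple-zero : ∀ x y z → triple u₅₄ u₁₄ x y z ≡ 0ℤ
  triple-zero = krein-vanishing u₅₄ u₁₄
    (trans (pair-sum-table _ _ (λ a _ → cong₂ (λ s r → s * (r * r)) (Φ-table u₅₄ a) (Φ-table u₁₄ a)) 0F) krein-zero)
    where
      Φ-table : ∀ φ h → Φ φ h ≡ Φᵗ φ h
      Φ-table φ = pair-sum-table (λ a b → φ a * φ b) _ (λ _ _ → refl)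

  no-triangle : ∀ x y z → dist x y ≡ 3F → dist x z ≡ 3F → dist y z ≡ 3F → ⊥
  no-triangle x y z xy xz yz =
    negative (subst (0ℤ ℤ.≤_) total (sum-nonneg _ (λ w → Λ-nonneg (dist x w) (dist y w) (dist z w))))
    where
      open ≡-Reasoning
      negative : ¬ (0ℤ ℤ.≤ - + 204000)
      negative ()
      at-3 : ∀ μ u v → dist u v ≡ 3F → ∑[ w < n ] μ (dist u w) (dist v w) ≡ ⟪ μ ⟫ᵗ 3F
      at-3 μ u v uv = trans (pair-sum μ u v) (trans (cong ⟪ μ ⟫ uv) (pair-sum-table μ μ (λ _ _ → refl) 3F))
      total : ∑[ w < n ] Λ (dist x w) (dist y w) (dist z w) ≡ - + 204000
      total = begin
        ∑[ w < n ] Λ (dist x w) (dist y w) (dist z w)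
          ≡⟨ ∑-combination (- + 2) (- + 1) (- + 1) _ _ _ (λ w → μ₁ (dist x w) (dist y w))
               (λ w → μ₂ (dist x w) (dist z w)) (λ w → μ₃ (dist y w) (dist z w)) ⟩
        - + 2 * triple u₅₄ u₁₄ x y z + (- + 1 * triple u₅₄ u₁₄ y x z + (- + 1 * triple u₅₄ u₁₄ z x y
          + (∑[ w < n ] μ₁ (dist x w) (dist y w) + (∑[ w < n ] μ₂ (dist x w) (dist z w)
          + ∑[ w < n ] μ₃ (dist y w) (dist z w)))))
          ≡⟨ cong₂ (λ t r → - + 2 * t + r) (triple-zero x y z)
               (cong₂ (λ t r → - + 1 * t + r) (triple-zero y x z)
               (cong₂ (λ t r → - + 1 * t + r) (triple-zero z x y)
               (cong₂ _+_ (at-3 μ₁ x y xy) (cong₂ _+_ (at-3 μ₂ x z xz) (at-3 μ₃ y z yz))))) ⟩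
        - + 2 * 0ℤ + (- + 1 * 0ℤ + (- + 1 * 0ℤ + (⟪ μ₁ ⟫ᵗ 3F + (⟪ μ₂ ⟫ᵗ 3F + ⟪ μ₃ ⟫ᵗ 3F))))
          ≡⟨ certificate-negative ⟩
        - + 204000 ∎

  -- but two vertices at distance 3 have p^3_{33} = 8 common vertices at distance 3
  no-distance-3 : ∀ u v → dist u v ≡ 3F → ⊥
  no-distance-3 u v uv = no-triangle u v z uv uz vz
    where
      common : ∃ λ z → dist u z ≡ 3F × dist v z ≡ 3F
      common = witness u v 3F 3F
        (trans (cong (λ d → p (toℕ d) 3 3) uv) (ℤ.+-injective (intersection-numbers 3F 3F 3F)))
      z : Fin n
      z = proj₁ common
      uz : dist u z ≡ 3F
      uz = proj₁ (proj₂ common)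
      vz : dist v z ≡ 3F
      vz = proj₂ (proj₂ common)

-- The diameter provides u, v at distance 3; the array (with c₃ ≠ 0) makes every distance
-- occur, so `GraphWithArray` applies and forbids the pair u, v.
theorem5 : (n : ℕ) (G : Graph n) →
    ¬ HasIntersectionArray G 3 (234 ∷ 165 ∷ 12 ∷ []) (1 ∷ 30 ∷ 198 ∷ [])
theorem5 n G (p , (_ , (diam , u , v , uv-at-3) , drg) , b , c) = no-distance-3 u v uv
  where
    open Distance G diam
    regular : ∀ u v (i j : Fin 4) → count G u v (toℕ i) (toℕ j) ≡ p (toℕ (dist u v)) (toℕ i) (toℕ j)
    regular u v i j = drg u v _ _ _ (toℕ≤pred[n] (dist u v)) (toℕ≤pred[n] i) (toℕ≤pred[n] j) (dist⇒isDist u v)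
    uv : dist u v ≡ 3F
    uv = isDist⇒dist 3F u v uv-at-3
    open DistanceRegular G diam p regular using (distances-occur)
    open GraphWithArray G diam p regular (distances-occur u v uv (sym (c 2F)))
           (sym (b 0F)) (sym (b 1F)) (sym (b 2F)) (sym (c 0F)) (sym (c 1F)) (sym (c 2F))
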